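{- Let $\mathcal C$ be a cocomplete locally small category and let $M$ be a class of morphisms of $\mathcal C$ whose domains and codomains are finitely presentable. Let $X_0\xrightarrow{x_0}X_1\xrightarrow{x_1}\cdots$ be a sequence of morphisms in $\mathcal C$ such that (i) each $x_n$ is a relative $M$-cell complex, and (ii) for every $f:A\to B$ in $M$, every $n\ge0$ and every $a:A\to X_n$ there exist $m\ge n$ and $b:B\to X_m$ with $b\circ f=x_{m-1}\circ\dots\circ x_n\circ a$. Then the canonical map $X_0\to X_\infty=\operatorname{colim}_n X_n$ is a weak reflection of $X_0$ into $M^\pitchfork$. If $M$ is strong, then $X_0\to X_\infty$ is a reflection.
   Context: An object $X$ is finitely presentable if $\mathrm{Hom}(X,-):\mathcal C\to\mathrm{Set}$ preserves filtered colimits. An object $X$ is injective to $f:A\to B$ if every $a:A\to X$ factors as $a=b\circ f$ for some $b:B\to X$, and orthogonal to $f$ if moreover $b$ is always unique. For a class $M$, $M^\pitchfork$ (resp. $M^\perp$) is the full subcategory of objects injective (resp. orthogonal) to every $f\in M$; $M$ is strong if $M^\pitchfork=M^\perp$. The class of relative $M$-cell complexes is the least class of morphisms containing $M$ and closed under set-indexed coproducts of morphisms, under pushouts along arbitrary maps, and under composition of countable sequences (the canonical map $A_0\to\operatorname{colim}_nA_n$ of a sequence $A_0\to A_1\to\cdots$ of maps in the class). For a full subcategory $\mathcal C'$, a weak reflection of $X$ into $\mathcal C'$ is a map $\eta:X\to X'$ with $X'\in\mathcal C'$ such that every map $X\to Y$ with $Y\in\mathcal C'$ factors through $\eta$; it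 is a reflection if the factorization is unique. -}

module Defs where

open import Level using (Level; _⊔_) renaming (suc to lsuc)
open import Data.Nat using (ℕ; zero; suc; _+_)
open import Data.Product using (Σ; _×_; _,_)
open import Relation.Binary.PropositionalEquality using (_≡_)

-- A (locally small) category: Hom-types live in Set ℓ, equality of
-- morphisms is propositional equality.
record Category (o ℓ : Level) : Set (lsuc (o ⊔ ℓ)) where
  infixr 9 _∘_
  field
    Obj : Set o
    Hom : Obj → Obj → Set ℓ
    id  : ∀ {A} → Hom A A
    _∘_ : ∀ {A B C} → Hom B C → Hom A B → Hom A C
    identityˡ : ∀ {A B} {f : Hom A B} → id ∘ f ≡ f
    identityʳ : ∀ {A B} {f : Hom A B} → f ∘ id ≡ f
    assoc : ∀ {A B C D} {f : Hom A B} {g : Hom B C} {h : Hom C D} →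
            (h ∘ g) ∘ f ≡ h ∘ (g ∘ f)

record Functor {o ℓ o' ℓ'} (J : Category o ℓ) (C : Category o' ℓ')
       : Set (o ⊔ ℓ ⊔ o' ⊔ ℓ') where
  private
    module J = Category J
    module C = Category C
  field
    F₀ : J.Obj → C.Obj
    F₁ : ∀ {i j} → J.Hom i j → C.Hom (F₀ i) (F₀ j)
    F-id : ∀ {i} → F₁ (J.id {i}) ≡ C.id
    F-∘ : ∀ {i j k} {u : J.Hom i j} {v : J.Hom j k} →
          F₁ (v J.∘ u) ≡ F₁ v C.∘ F₁ u

∃! : ∀ {a p} {A : Set a} → (A → Set p) → Set (a ⊔ p)
∃! {A = A} P = Σ A λ x → P x × (∀ y → P y → y ≡ x)

record Filtered {o ℓ} (J : Category o ℓ) : Set (o ⊔ ℓ) where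
  open Category J
  field
    nonempty : Obj
    cone : ∀ i j → Σ Obj λ k → Hom i k × Hom j k
    coeq : ∀ {i j} (u v : Hom i j) → Σ Obj λ k → Σ (Hom j k) λ w → w ∘ u ≡ w ∘ v

module _ {o ℓ : Level} (C : Category o ℓ) where
  open Category C

  record Cocone {oj ℓj} {J : Category oj ℓj} (D : Functor J C)
         : Set (o ⊔ ℓ ⊔ oj ⊔ ℓj) where
    open Functor D
    private module J = Category J
    field
      apex : Obj
      ψ : ∀ j → Hom (F₀ j) apex
      commute : ∀ {i j} (u : J.Hom i j) → ψ j ∘ F₁ u ≡ ψ i

  IsColimit : ∀ {oj ℓj} {J : Category oj ℓj} {D : Functor J C} →
              Cocone D → Set (o ⊔ ℓ ⊔ oj ⊔ ℓj)
  IsColimit {D = D} c = ∀ (K : Cocone D) →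
    ∃! λ (h : Hom (Cocone.apex c) (Cocone.apex K)) →
      ∀ j → h ∘ Cocone.ψ c j ≡ Cocone.ψ K j

  -- cocomplete: every small diagram (indexed by a category whose objects
  -- and morphisms live in Set ℓ) has a colimit
  Cocomplete : Set (o ⊔ lsuc ℓ)
  Cocomplete = ∀ (J : Category ℓ ℓ) (D : Functor J C) →
               Σ (Cocone D) IsColimit

  -- Hom(X,-) preserves filtered colimits: the canonical map
  -- colim_j Hom(X, D j) → Hom(X, colim D) is bijective (written out using
  -- the standard description of filtered colimits in Set).
  FinitelyPresentable : Obj → Set (o ⊔ lsuc ℓ)
  FinitelyPresentable X =
    ∀ (J : Category ℓ ℓ) → Filtered J → (D : Functor J C) →
    (c : Cocone D) → IsColimit c →
    let open Functor D
        open Cocone c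
        module J = Category J
    in (∀ (g : Hom X apex) → Σ J.Obj λ j → Σ (Hom X (F₀ j)) λ h → ψ j ∘ h ≡ g)
     × (∀ j (h h' : Hom X (F₀ j)) → ψ j ∘ h ≡ ψ j ∘ h' →
          Σ J.Obj λ k → Σ (J.Hom j k) λ u → F₁ u ∘ h ≡ F₁ u ∘ h')

  IsCoproduct : {I : Set ℓ} (A : I → Obj) (S : Obj) →
                (∀ i → Hom (A i) S) → Set (o ⊔ ℓ)
  IsCoproduct {I} A S ι = ∀ (Y : Obj) (g : ∀ i → Hom (A i) Y) →
    ∃! λ (h : Hom S Y) → ∀ i → h ∘ ι i ≡ g i

  IsPushout : ∀ {A B A' P} (f : Hom A B) (a : Hom A A')
              (f' : Hom A' P) (a' : Hom B P) → Set (o ⊔ ℓ)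
  IsPushout {A} {B} {A'} {P} f a f' a' =
    (f' ∘ a ≡ a' ∘ f) ×
    (∀ Y (u : Hom A' Y) (v : Hom B Y) → u ∘ a ≡ v ∘ f →
      ∃! λ (h : Hom P Y) → (h ∘ f' ≡ u) × (h ∘ a' ≡ v))

  IsSeqColimit : (A : ℕ → Obj) (g : ∀ n → Hom (A n) (A (suc n)))
                 (L : Obj) (λ' : ∀ n → Hom (A n) L) → Set (o ⊔ ℓ)
  IsSeqColimit A g L λ' =
    (∀ n → λ' (suc n) ∘ g n ≡ λ' n) ×
    (∀ Y (μ : ∀ n → Hom (A n) Y) → (∀ n → μ (suc n) ∘ g n ≡ μ n) →
      ∃! λ (h : Hom L Y) → ∀ n → h ∘ λ' n ≡ μ n)

  module _ {m : Level} (M : ∀ {A B} → Hom A B → Set m) where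

    data Cell : ∀ {A B} → Hom A B → Set (o ⊔ lsuc ℓ ⊔ m) where
      base : ∀ {A B} {f : Hom A B} → M f → Cell f
      coprod : ∀ {I : Set ℓ} {A B : I → Obj} {f : ∀ i → Hom (A i) (B i)} →
               (∀ i → Cell (f i)) →
               ∀ {SA SB} (ι : ∀ i → Hom (A i) SA) (κ : ∀ i → Hom (B i) SB) →
               IsCoproduct A SA ι → IsCoproduct B SB κ →
               (g : Hom SA SB) → (∀ i → g ∘ ι i ≡ κ i ∘ f i) → Cell g
      pushout : ∀ {A B A' P} {f : Hom A B} → Cell f →
                (a : Hom A A') (f' : Hom A' P) (a' : Hom B P) →
                IsPushout f a f' a' → Cell f'
      seq : ∀ {A : ℕ → Obj} {g : ∀ n → Hom (A n) (A (suc n))} →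
            (∀ n → Cell (g n)) →
            ∀ L (λ' : ∀ n → Hom (A n) L) → IsSeqColimit A g L λ' →
            Cell (λ' 0)

    InjectiveTo : Obj → ∀ {A B} → Hom A B → Set ℓ
    InjectiveTo X {A} {B} f = ∀ (a : Hom A X) → Σ (Hom B X) λ b → b ∘ f ≡ a

    OrthogonalTo : Obj → ∀ {A B} → Hom A B → Set ℓ
    OrthogonalTo X {A} {B} f = ∀ (a : Hom A X) → ∃! λ (b : Hom B X) → b ∘ f ≡ a

    InjM : Obj → Set (o ⊔ ℓ ⊔ m)
    InjM X = ∀ {A B} (f : Hom A B) → M f → InjectiveTo X f

    OrthM : Obj → Set (o ⊔ ℓ ⊔ m)
    OrthM X = ∀ {A B} (f : Hom A B) → M f → OrthogonalTo X f

    Strong : Set (o ⊔ ℓ ⊔ m)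
    Strong = ∀ X → (InjM X → OrthM X) × (OrthM X → InjM X)

  IsWeakReflection : ∀ {p} (P : Obj → Set p) {X X'} → Hom X X' → Set (o ⊔ ℓ ⊔ p)
  IsWeakReflection P {X} {X'} η =
    P X' × (∀ Y → P Y → (g : Hom X Y) → Σ (Hom X' Y) λ h → h ∘ η ≡ g)

  IsReflection : ∀ {p} (P : Obj → Set p) {X X'} → Hom X X' → Set (o ⊔ ℓ ⊔ p)
  IsReflection P {X} {X'} η =
    P X' × (∀ Y → P Y → (g : Hom X Y) → ∃! λ (h : Hom X' Y) → h ∘ η ≡ g)

  -- x_{n+k-1} ∘ ⋯ ∘ x_n : X n → X (k + n)
  chain : (X : ℕ → Obj) (x : ∀ n → Hom (X n) (X (suc n))) →
          ∀ n k → Hom (X n) (X (k + n))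
  chain X x n zero = id
  chain X x n (suc k) = x (k + n) ∘ chain X x n k

{-# OPTIONS --safe #-}

-- The colimit X∞ is injective to every f : A → B in M: a map A → X∞ factors
-- through some X n because A is finitely presentable, and hypothesis (ii)
-- extends that factor along f at a later stage.  The map X 0 → X∞ is itself a
-- relative M-cell complex, and injectivity (resp. orthogonality) to M passes
-- to all M-cell complexes by induction on their construction; for orthogonal
-- objects this gives uniqueness of the factorisation.
module Submission where

open import Defs
open import Level using (Level; Lift; lift; lower)
open import Data.Nat using (ℕ; zero; suc; _+_; _≤′_; ≤′-reflexive; ≤′-refl; ≤′-step)
open import Data.Nat.Properties using (≤′-trans; ≤′⇒≤; ≤⇒≤′; m≤m+n; m≤n+m; ≡-irrelevant; 1+n≰n)
open import Data.Product using (Σ; _×_; _,_; proj₁; proj₂)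
open import Data.Empty using (⊥-elim)
open import Relation.Binary.PropositionalEquality using (_≡_; refl; sym; trans; cong)
open Relation.Binary.PropositionalEquality.≡-Reasoning

≤′-irrelevant : ∀ {m n} (p q : m ≤′ n) → p ≡ q
≤′-irrelevant (≤′-reflexive e) (≤′-reflexive e') = cong ≤′-reflexive (≡-irrelevant e e')
≤′-irrelevant ≤′-refl (≤′-step q) = ⊥-elim (1+n≰n (≤′⇒≤ q))
≤′-irrelevant (≤′-step p) ≤′-refl = ⊥-elim (1+n≰n (≤′⇒≤ p))
≤′-irrelevant (≤′-step p) (≤′-step q) = cong ≤′-step (≤′-irrelevant p q)

∃!-unique : ∀ {a p} {A : Set a} {P : A → Set p} → ∃! P → ∀ {y z} → P y → P z → y ≡ z
∃!-unique (_ , _ , unique) py pz = trans (unique _ py) (sym (unique _ pz))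

module _ {o ℓ : Level} (C : Category o ℓ) where
  open Category C

  pullʳ : ∀ {W X Y Z} {f : Hom W X} {g : Hom X Y} {h : Hom W Y} {k : Hom Y Z} →
          g ∘ f ≡ h → (k ∘ g) ∘ f ≡ k ∘ h
  pullʳ {k = k} e = trans assoc (cong (k ∘_) e)

  transport-along-square : ∀ {A B A' P Y} {f : Hom A B} {i : Hom A A'} {g : Hom A' P} {k : Hom B P}
                  {u v : Hom P Y} → g ∘ i ≡ k ∘ f → u ∘ g ≡ v ∘ g → (u ∘ k) ∘ f ≡ (v ∘ k) ∘ f
  transport-along-square {f = f} {i} {g} {k} {u} {v} sq e = begin
    (u ∘ k) ∘ f  ≡⟨ pullʳ (sym sq) ⟩
    u ∘ (g ∘ i)  ≡⟨ sym assoc ⟩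
    (u ∘ g) ∘ i  ≡⟨ cong (_∘ i) e ⟩
    (v ∘ g) ∘ i  ≡⟨ pullʳ sq ⟩
    v ∘ (k ∘ f)  ≡⟨ sym assoc ⟩
    (v ∘ k) ∘ f  ∎

  module _ {m : Level} {M : ∀ {A B} → Hom A B → Set m} {Y : Obj} where

    InjM⇒injective-to-Cell : InjM C M Y → ∀ {A B} {f : Hom A B} → Cell C M f → InjectiveTo C M Y f
    InjM⇒injective-to-Cell inj (base mf) a = inj _ mf a
    InjM⇒injective-to-Cell inj (coprod {f = f} cells ι κ cpA cpB g sq) a =
      h , ∃!-unique (cpA Y (λ i → a ∘ ι i)) h∘g-extends (λ _ → refl)
      where
        b : ∀ i → _
        b i = InjM⇒injective-to-Cell inj (cells i) (a ∘ ι i)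
        copair = cpB Y (λ i → proj₁ (b i))
        h = proj₁ copair
        h∘g-extends : ∀ i → (h ∘ g) ∘ ι i ≡ a ∘ ι i
        h∘g-extends i = begin
          (h ∘ g) ∘ ι i      ≡⟨ pullʳ (sq i) ⟩
          h ∘ (κ i ∘ f i)    ≡⟨ sym assoc ⟩
          (h ∘ κ i) ∘ f i    ≡⟨ cong (_∘ f i) (proj₁ (proj₂ copair) i) ⟩
          proj₁ (b i) ∘ f i  ≡⟨ proj₂ (b i) ⟩
          a ∘ ι i            ∎
    InjM⇒injective-to-Cell inj (pushout cell a₀ f' a' po) a =
      let b = InjM⇒injective-to-Cell inj cell (a ∘ a₀)
          h = proj₂ po Y a (proj₁ b) (sym (proj₂ b))
      in proj₁ h , proj₁ (proj₁ (proj₂ h))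
    InjM⇒injective-to-Cell inj (seq {A = A} cells L λ' col) a =
      proj₁ h , proj₁ (proj₂ h) 0
      where
        μ : ∀ n → Hom (A n) Y
        μ zero = a
        μ (suc n) = proj₁ (InjM⇒injective-to-Cell inj (cells n) (μ n))
        h = proj₂ col Y μ (λ n → proj₂ (InjM⇒injective-to-Cell inj (cells n) (μ n)))

    OrthM⇒Cell-cancelʳ : OrthM C M Y → ∀ {A B} {f : Hom A B} → Cell C M f →
                     ∀ (u v : Hom B Y) → u ∘ f ≡ v ∘ f → u ≡ v
    OrthM⇒Cell-cancelʳ orth (base {f = f} mf) u v e =
      ∃!-unique (orth f mf (u ∘ f)) refl (sym e)
    OrthM⇒Cell-cancelʳ orth (coprod cells ι κ cpA cpB g sq) u v e =
      ∃!-unique (cpB Y (λ i → v ∘ κ i))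
        (λ i → OrthM⇒Cell-cancelʳ orth (cells i) _ _ (transport-along-square (sq i) e))
        (λ _ → refl)
    OrthM⇒Cell-cancelʳ orth (pushout cell a₀ f' a' po) u v e =
      ∃!-unique (proj₂ po Y (u ∘ f') (u ∘ a') (trans (pullʳ (proj₁ po)) (sym assoc)))
        (refl , refl)
        (sym e , sym (OrthM⇒Cell-cancelʳ orth cell _ _ (transport-along-square (proj₁ po) e)))
    OrthM⇒Cell-cancelʳ orth (seq {g = g} cells L λ' col) u v e =
      ∃!-unique (proj₂ col Y (λ n → v ∘ λ' n) (λ n → pullʳ (proj₁ col n)))
        agree (λ _ → refl)
      where
        agree : ∀ n → u ∘ λ' n ≡ v ∘ λ' n
        agree zero = e
        agree (suc n) = OrthM⇒Cell-cancelʳ orth (cells n) _ _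
          (transport-along-square (trans identityʳ (sym (proj₁ col n))) (agree n))

  module _ (X : ℕ → Obj) (x : ∀ n → Hom (X n) (X (suc n))) where

    chain-cocone : ∀ {Y} (μ : ∀ n → Hom (X n) Y) → (∀ n → μ (suc n) ∘ x n ≡ μ n) →
                   ∀ n k → μ (k + n) ∘ chain C X x n k ≡ μ n
    chain-cocone μ commute n zero = identityʳ
    chain-cocone μ commute n (suc k) = begin
      μ (suc (k + n)) ∘ (x (k + n) ∘ chain C X x n k)  ≡⟨ sym assoc ⟩
      (μ (suc (k + n)) ∘ x (k + n)) ∘ chain C X x n k  ≡⟨ cong (_∘ chain C X x n k) (commute (k + n)) ⟩
      μ (k + n) ∘ chain C X x n k                      ≡⟨ chain-cocone μ commute n k ⟩
      μ n                                              ∎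

    hop : ∀ {i j} → i ≤′ j → Hom (X i) (X j)
    hop ≤′-refl = id
    hop (≤′-step {n} p) = x n ∘ hop p

    hop-∘ : ∀ {i j k} (p : i ≤′ j) (q : j ≤′ k) → hop (≤′-trans p q) ≡ hop q ∘ hop p
    hop-∘ p ≤′-refl = sym identityˡ
    hop-∘ p (≤′-step {n} q) = trans (cong (x n ∘_) (hop-∘ p q)) (sym assoc)

    hop-cocone : ∀ {Y} (μ : ∀ n → Hom (X n) Y) → (∀ n → μ (suc n) ∘ x n ≡ μ n) →
                 ∀ {i j} (p : i ≤′ j) → μ j ∘ hop p ≡ μ i
    hop-cocone μ commute ≤′-refl = identityʳ
    hop-cocone μ commute (≤′-step {n} p) =
      trans (sym assoc) (trans (cong (_∘ hop p) (commute n)) (hop-cocone μ commute p))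

lift-≤′-irrelevant : ∀ {ℓ i j} {p q : Lift ℓ (i ≤′ j)} → p ≡ q
lift-≤′-irrelevant {p = lift p} {lift q} = cong lift (≤′-irrelevant p q)

ω : ∀ ℓ → Category ℓ ℓ
ω ℓ = record
  { Obj = Lift ℓ ℕ
  ; Hom = λ i j → Lift ℓ (lower i ≤′ lower j)
  ; id = lift ≤′-refl
  ; _∘_ = λ q p → lift (≤′-trans (lower p) (lower q))
  ; identityˡ = lift-≤′-irrelevant
  ; identityʳ = lift-≤′-irrelevant
  ; assoc = lift-≤′-irrelevant
  }

ω-filtered : ∀ ℓ → Filtered (ω ℓ)
ω-filtered ℓ = record
  { nonempty = lift 0
  ; cone = λ i j → lift (lower i + lower j)
                 , lift (≤⇒≤′ (m≤m+n (lower i) (lower j)))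
                 , lift (≤⇒≤′ (m≤n+m (lower j) (lower i)))
  ; coeq = λ {_} {j} _ _ → j , lift ≤′-refl , lift-≤′-irrelevant
  }

module _ {o ℓ : Level} (C : Category o ℓ) (X : ℕ → Category.Obj C)
         (x : ∀ n → Category.Hom C (X n) (X (suc n))) where
  open Category C

  sequence-diagram : Functor (ω ℓ) C
  sequence-diagram = record
    { F₀ = λ i → X (lower i)
    ; F₁ = λ p → hop C X x (lower p)
    ; F-id = refl
    ; F-∘ = λ {_} {_} {_} {u} {v} → hop-∘ C X x (lower u) (lower v)
    }

  module _ {X∞ : Obj} {ι : ∀ n → Hom (X n) X∞} (col : IsSeqColimit C X x X∞ ι) where

    sequence-cocone : Cocone C sequence-diagram
    sequence-cocone = record
      { apex = X∞
      ; ψ = λ j → ι (lower j)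
      ; commute = λ u → hop-cocone C X x ι (proj₁ col) (lower u)
      }

    IsSeqColimit⇒IsColimit : IsColimit C sequence-cocone
    IsSeqColimit⇒IsColimit K =
      proj₁ h , (λ j → proj₁ (proj₂ h) (lower j)) , (λ y hy → proj₂ (proj₂ h) y (λ n → hy (lift n)))
      where
        open Cocone K
        commute-step : ∀ n → ψ (lift (suc n)) ∘ x n ≡ ψ (lift n)
        commute-step n = trans (cong (ψ (lift (suc n)) ∘_) (sym identityʳ))
                               (commute (lift (≤′-step ≤′-refl)))
        h = proj₂ col apex (λ n → ψ (lift n)) commute-step

    seqColimit-injective :
      {m : Level} {M : ∀ {A B} → Hom A B → Set m} →
      (∀ {A B} (f : Hom A B) → M f → FinitelyPresentable C A) →
      (∀ {A B} (f : Hom A B) → M f → ∀ n (a : Hom A (X n)) →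
        Σ ℕ λ k → Σ (Hom B (X (k + n))) λ b → b ∘ f ≡ chain C X x n k ∘ a) →
      InjM C M X∞
    seqColimit-injective fp extend f mf a = ι (k + n) ∘ b , (begin
      (ι (k + n) ∘ b) ∘ f                ≡⟨ pullʳ C b∘f ⟩
      ι (k + n) ∘ (chain C X x n k ∘ a₀)  ≡⟨ sym assoc ⟩
      (ι (k + n) ∘ chain C X x n k) ∘ a₀  ≡⟨ cong (_∘ a₀) (chain-cocone C X x ι (proj₁ col) n k) ⟩
      ι n ∘ a₀                           ≡⟨ ι∘a₀ ⟩
      a                                  ∎)
      where
        factor = proj₁ (fp f mf (ω ℓ) (ω-filtered ℓ) sequence-diagram sequence-cocone IsSeqColimit⇒IsColimit) a
        n = lower (proj₁ factor)
        a₀ = proj₁ (proj₂ factor)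
        ι∘a₀ = proj₂ (proj₂ factor)
        extension = extend f mf n a₀
        k = proj₁ extension
        b = proj₁ (proj₂ extension)
        b∘f = proj₂ (proj₂ extension)

proposition2p14 : ∀ {o ℓ m : Level} (C : Category o ℓ) → Cocomplete C →
    let open Category C in
    (M : ∀ {A B} → Hom A B → Set m) →
    (∀ {A B} (f : Hom A B) → M f →
    FinitelyPresentable C A × FinitelyPresentable C B) →
    (X : ℕ → Obj) (x : ∀ n → Hom (X n) (X (suc n))) →
    (∀ n → Cell C M (x n)) →
    (∀ {A B} (f : Hom A B) → M f → ∀ n (a : Hom A (X n)) →
    Σ ℕ λ k → Σ (Hom B (X (k + n))) λ b → b ∘ f ≡ chain C X x n k ∘ a) →
    (X∞ : Obj) (ι : ∀ n → Hom (X n) X∞) → IsSeqColimit C X x X∞ ι →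
    IsWeakReflection C (InjM C M) (ι 0)
    × (Strong C M → IsReflection C (InjM C M) (ι 0))
proposition2p14 C _ M fp X x cells extend X∞ ι col =
  (X∞-injective , factor) , λ strong → X∞-injective , λ Y injY g →
    let (h , h∘ι₀) = factor Y injY g in
    h , h∘ι₀ , λ h' h'∘ι₀ →
      OrthM⇒Cell-cancelʳ C (proj₁ (strong Y) injY) ι₀-cell h' h (trans h'∘ι₀ (sym h∘ι₀))
  where
    open Category C
    X∞-injective : InjM C M X∞
    X∞-injective = seqColimit-injective C X x col (λ f mf → proj₁ (fp f mf)) extend

    ι₀-cell : Cell C M (ι 0)
    ι₀-cell = seq cells X∞ ι col

    factor : ∀ Y → InjM C M Y → (g : Hom (X 0) Y) → Σ (Hom X∞ Y) λ h → h ∘ ι 0 ≡ g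
    factor Y injY = InjM⇒injective-to-Cell C injY ι₀-cell
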